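{- Let $n\ge 2$, and let $n$ cars, numbered $1,\dotsc,n$, enter in this order a one-way street with $n$ consecutive spots, where driver $i$ prefers the spot label $p(i)\in[n-1]$. Then there is a unique $k\in[n-1]$ such that all cars can park, in the sense described below, when the $n$ spots are labeled consecutively (in the direction of travel) by \[k,\,k,\,k+1,\dotsc,n-1,\,1,\,2,\dotsc,k-1.\]
   Context: $[m]=\{1,\dotsc,m\}$. Parking rule: given a labeling of the $n$ spots of the street (in order of travel) by labels from $[n-1]$, where exactly one label occurs twice (in two adjacent spots) and every other label occurs once, the cars arrive one at a time in the order $1,2,\dotsc,n$. Driver $i$ drives to the first spot (in the direction of travel) carrying the label $p(i)$; if that spot is free he parks there, and otherwise he parks in the first free spot after it along the street; if no such free spot exists he leaves the street. "All cars can park" means no driver leaves the street. -}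

module Defs where

open import Data.Nat using (ℕ; zero; suc; _+_; _∸_; _≡ᵇ_; _≤ᵇ_)
open import Data.Bool using (Bool; true; false; if_then_else_; not)
open import Data.List using (List; []; _∷_; map)
open import Data.Bool.ListAction using (any)
open import Data.Maybe using (Maybe; just; nothing)
open import Data.Fin using (Fin; toℕ)
open import Data.List using (allFin)

-- All spots are indexed 0,1,...,n-1 in the direction of travel.
-- Labels are natural numbers (the paper's labels 1,...,n-1).

firstFrom : (s c : ℕ) → (ℕ → Bool) → Maybe ℕ
firstFrom s zero    P = nothing
firstFrom s (suc c) P = if P s then just s else firstFrom (suc s) c P

occ : List ℕ → ℕ → Bool
occ os j = any (λ o → o ≡ᵇ j) os

firstLabelled : (n : ℕ) → (ℕ → ℕ) → ℕ → Maybe ℕ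
firstLabelled n L a = firstFrom 0 n (λ j → L j ≡ᵇ a)

firstFreeFrom : (n : ℕ) → List ℕ → ℕ → Maybe ℕ
firstFreeFrom n os j = firstFrom j (n ∸ j) (λ i → not (occ os i))

-- run the parking process: street of n spots with labeling L,
-- remaining drivers' preferred labels (in arrival order), occupied spots;
-- returns true iff no driver leaves the street
allParkFrom : (n : ℕ) → (ℕ → ℕ) → List ℕ → List ℕ → Bool
allParkFrom n L []       os = true
allParkFrom n L (a ∷ as) os with firstLabelled n L a
... | nothing = false
... | just j with firstFreeFrom n os j
...   | nothing = false
...   | just s  = allParkFrom n L as (s ∷ os)

allPark : (n : ℕ) → (ℕ → ℕ) → List ℕ → Bool
allPark n L prefs = allParkFrom n L prefs []

-- The labeling  k, k, k+1, ..., n-1, 1, 2, ..., k-1  of spots 0..n-1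
-- (k is the actual label value, 1 ≤ k ≤ n-1).
streetLabel : (n k : ℕ) → ℕ → ℕ
streetLabel n k zero    = k
streetLabel n k (suc j) = let v = k + j in
  if v ≤ᵇ (n ∸ 1) then v else v ∸ (n ∸ 1)

-- preference p(i) ∈ [n-1] encoded as Fin (n-1) with value toℕ + 1;
-- list of preferred labels for cars 1..n in arrival order
prefList : {n l : ℕ} → (Fin n → Fin l) → List ℕ
prefList {n} p = map (λ i → suc (toℕ (p i))) (allFin n)

labelOf : {l : ℕ} → Fin l → ℕ
labelOf k = suc (toℕ k)

-- Driver i heads for the first spot labelled p(i), which depends only on the street; hence all
-- drivers park iff for every j at most n − j of them head for one of the spots j, …, n − 1, a
-- Hall-type condition that each parking step preserves. On the street k, k, k + 1, … the spots
-- t + 1, …, n − 1 (t ≥ 1) carry the labels k + t, …, n − 1, 1, …, k − 1 read cyclically, so with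
-- S(r) = #{i : p(i) ≤ r} − r the condition says that S attains its minimum over 0, …, n − 1 at
-- k − 1 and nowhere later: intervals that do not wrap around compare S(k − 1) with S(r) for
-- r ≥ k, those that do compare it with S(s) for s < k, because S(n − 1) = 1. Such a last
-- minimiser exists, is unique, and is not n − 1 since S(n − 1) = 1 > 0 = S(0).

module Submission where

open import Defs
open import Data.Bool using (Bool; true; false; T; not; if_then_else_)
open import Data.Empty using (⊥-elim)
open import Data.Fin using (Fin; toℕ; fromℕ<)
open import Data.Fin.Properties using (toℕ<n; toℕ-fromℕ<; toℕ-injective)
open import Data.List using (List; []; _∷_; length; map; allFin)
open import Data.List.Properties using (length-map; length-tabulate)
open import Data.List.Relation.Unary.All as All using (All; []; _∷_)
open import Data.List.Relation.Unary.All.Properties using (map⁺; tabulate⁺)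
open import Data.Maybe using (just; nothing)
open import Data.Nat using (ℕ; zero; suc; _+_; _∸_; _≤_; _<_; _≤ᵇ_; _≡ᵇ_; z≤n; s≤s; s≤s⁻¹; z<s)
open import Data.Nat.ListAction using (sum)
open import Data.Nat.Properties
open import Algebra.Properties.CommutativeSemigroup +-commutativeSemigroup using (interchange; x∙yz≈y∙xz)
open import Data.Nat.Tactic.RingSolver using (solve-∀)
open import Data.Product using (∃; ∃!; _×_; _,_; proj₁; proj₂)
open import Data.Sum using (inj₁; inj₂)
open import Data.Unit using (tt)
open import Function using (id)
open import Function.Bundles using (_⇔_; mk⇔; Equivalence)
open import Function.Properties.Equivalence using (⇔-setoid) renaming (trans to ⇔-trans)
open import Level using (0ℓ)
open import Relation.Binary using (tri<; tri≈; tri>)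
open import Relation.Binary.PropositionalEquality
open import Relation.Nullary using (Dec; yes; no)
import Relation.Binary.Reasoning.Setoid as SetoidReasoning

𝟙 : Bool → ℕ
𝟙 b = if b then 1 else 0

≤ᵇ-true : ∀ {m n} → m ≤ n → (m ≤ᵇ n) ≡ true
≤ᵇ-true {m} {n} m≤n with m ≤ᵇ n in eq
... | true  = refl
... | false = ⊥-elim (subst T eq (≤⇒≤ᵇ m≤n))

≤ᵇ-false : ∀ {m n} → n < m → (m ≤ᵇ n) ≡ false
≤ᵇ-false {m} {n} n<m with m ≤ᵇ n in eq
... | false = refl
... | true  = ⊥-elim (<⇒≱ n<m (≤ᵇ⇒≤ m n (subst T (sym eq) tt)))

≡ᵇ-refl : ∀ m → (m ≡ᵇ m) ≡ true
≡ᵇ-refl zero    = refl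
≡ᵇ-refl (suc m) = ≡ᵇ-refl m

≡ᵇ-false : ∀ {m n} → m ≢ n → (m ≡ᵇ n) ≡ false
≡ᵇ-false {m} {n} m≢n with m ≡ᵇ n in eq
... | false = refl
... | true  = ⊥-elim (m≢n (≡ᵇ⇒≡ m n (subst T (sym eq) tt)))

not-true : ∀ {b} → not b ≡ true → b ≡ false
not-true {false} _ = refl

not-false : ∀ {b} → not b ≡ false → b ≡ true
not-false {true} _ = refl

𝟙-≤ᵇ-antitone : ∀ {i j} x → i ≤ j → 𝟙 (j ≤ᵇ x) ≤ 𝟙 (i ≤ᵇ x)
𝟙-≤ᵇ-antitone {i} {j} x i≤j with j ≤? x
... | yes j≤x rewrite ≤ᵇ-true j≤x | ≤ᵇ-true (≤-trans i≤j j≤x) = ≤-refl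
... | no  j≰x rewrite ≤ᵇ-false (≰⇒> j≰x) = z≤n

sum-map-+ : ∀ (f g : ℕ → ℕ) xs → sum (map (λ x → f x + g x) xs) ≡ sum (map f xs) + sum (map g xs)
sum-map-+ f g []       = refl
sum-map-+ f g (x ∷ xs) rewrite sum-map-+ f g xs = interchange (f x) (g x) _ _

sum-map-cong : ∀ {P : ℕ → Set} (f g : ℕ → ℕ) → (∀ x → P x → f x ≡ g x) → ∀ {xs} → All P xs →
  sum (map f xs) ≡ sum (map g xs)
sum-map-cong f g f≡g []         = refl
sum-map-cong f g f≡g (px ∷ pxs) = cong₂ _+_ (f≡g _ px) (sum-map-cong f g f≡g pxs)

sum-map-zero : ∀ {P : ℕ → Set} (f : ℕ → ℕ) → (∀ x → P x → f x ≡ 0) → ∀ {xs} → All P xs →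
  sum (map f xs) ≡ 0
sum-map-zero f f≡0 []         = refl
sum-map-zero f f≡0 (px ∷ pxs) = cong₂ _+_ (f≡0 _ px) (sum-map-zero f f≡0 pxs)

sum-map-one : ∀ {A : Set} (xs : List A) → sum (map (λ _ → 1) xs) ≡ length xs
sum-map-one []       = refl
sum-map-one (x ∷ xs) = cong suc (sum-map-one xs)

sum-map-mono : ∀ (f g : ℕ → ℕ) → (∀ x → f x ≤ g x) → ∀ xs → sum (map f xs) ≤ sum (map g xs)
sum-map-mono f g f≤g []       = z≤n
sum-map-mono f g f≤g (x ∷ xs) = +-mono-≤ (f≤g x) (sum-map-mono f g f≤g xs)

+-monoˡ-≤-⇔ : ∀ {m n} p → m ≤ n ⇔ m + p ≤ n + p
+-monoˡ-≤-⇔ p = mk⇔ (+-monoˡ-≤ p) (+-cancelʳ-≤ p _ _)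

+-monoʳ-≤-⇔ : ∀ {m n} p → m ≤ n ⇔ p + m ≤ p + n
+-monoʳ-≤-⇔ p = mk⇔ (+-monoʳ-≤ p) (+-cancelˡ-≤ p _ _)

1+m+n∸m≡1+n : ∀ m n → suc m + n ∸ m ≡ suc n
1+m+n∸m≡1+n m n = trans (cong (_∸ m) (sym (+-suc m n))) (m+n∸m≡n m (suc n))

record IsFirstFrom (s c : ℕ) (P : ℕ → Bool) (j : ℕ) : Set where
  field
    lower  : s ≤ j
    upper  : j < s + c
    holds  : P j ≡ true
    before : ∀ i → s ≤ i → i < j → P i ≡ false

firstFrom-just : ∀ s c P {j} → firstFrom s c P ≡ just j → IsFirstFrom s c P j
firstFrom-just s (suc c) P eq with P s in Ps
... | true with eq
...   | refl = record { lower = ≤-refl ; upper = m<m+n s z<s ; holds = Ps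
                      ; before = λ i s≤i i<s → ⊥-elim (<⇒≱ i<s s≤i) }
firstFrom-just s (suc c) P {j} eq | false = record
  { lower  = <⇒≤ lower
  ; upper  = subst (j <_) (sym (+-suc s c)) upper
  ; holds  = holds
  ; before = before′ }
  where
  open IsFirstFrom (firstFrom-just (suc s) c P eq)
  before′ : ∀ i → s ≤ i → i < j → P i ≡ false
  before′ i s≤i i<j with m≤n⇒m<n∨m≡n s≤i
  ... | inj₁ s<i  = before i s<i i<j
  ... | inj₂ refl = Ps

firstFrom-nothing : ∀ s c P → firstFrom s c P ≡ nothing → ∀ i → s ≤ i → i < s + c → P i ≡ false
firstFrom-nothing s zero P eq i s≤i i<s+0 = ⊥-elim (<⇒≱ i<s+0 (subst (_≤ i) (sym (+-identityʳ s)) s≤i))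
firstFrom-nothing s (suc c) P eq i s≤i i<s+c with P s in Ps
firstFrom-nothing s (suc c) P () i s≤i i<s+c | true
... | false with m≤n⇒m<n∨m≡n s≤i
...   | inj₁ s<i  = firstFrom-nothing (suc s) c P eq i s<i (subst (i <_) (+-suc s c) i<s+c)
...   | inj₂ refl = Ps

IsFirstFrom⇒firstFrom : ∀ s c P {j} → IsFirstFrom s c P j → firstFrom s c P ≡ just j
IsFirstFrom⇒firstFrom s zero P first =
  ⊥-elim (<⇒≱ upper (subst (_≤ _) (sym (+-identityʳ s)) lower))
  where open IsFirstFrom first
IsFirstFrom⇒firstFrom s (suc c) P {j} first with m≤n⇒m<n∨m≡n (IsFirstFrom.lower first)
... | inj₂ refl rewrite IsFirstFrom.holds first = refl
... | inj₁ s<j rewrite IsFirstFrom.before first s ≤-refl s<j =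
  IsFirstFrom⇒firstFrom (suc s) c P record
    { lower  = s<j
    ; upper  = subst (j <_) (+-suc s c) upper
    ; holds  = holds
    ; before = λ i s<i i<j → before i (<⇒≤ s<i) i<j }
  where open IsFirstFrom first

firstLabelled-char : ∀ n L a {p} → p < n → L p ≡ a → (∀ i → i < p → L i ≢ a) →
  firstLabelled n L a ≡ just p
firstLabelled-char n L a p<n Lp≡a earlier = IsFirstFrom⇒firstFrom 0 n _ record
  { lower  = z≤n
  ; upper  = p<n
  ; holds  = trans (cong (_≡ᵇ a) Lp≡a) (≡ᵇ-refl a)
  ; before = λ i _ i<p → ≡ᵇ-false (earlier i i<p) }

freeCount : List ℕ → ℕ → ℕ → ℕ
freeCount os j zero    = 0
freeCount os j (suc c) = 𝟙 (not (occ os j)) + freeCount os (suc j) c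

freeCount-+ : ∀ os j c d → freeCount os j (c + d) ≡ freeCount os j c + freeCount os (j + c) d
freeCount-+ os j zero    d = cong (λ i → freeCount os i d) (sym (+-identityʳ j))
freeCount-+ os j (suc c) d rewrite freeCount-+ os (suc j) c d | +-suc j c =
  sym (+-assoc (𝟙 (not (occ os j))) _ _)

freeCount-[] : ∀ j c → freeCount [] j c ≡ c
freeCount-[] j zero    = refl
freeCount-[] j (suc c) = cong suc (freeCount-[] (suc j) c)

freeCount-occupied : ∀ os j c → (∀ i → j ≤ i → i < j + c → occ os i ≡ true) → freeCount os j c ≡ 0
freeCount-occupied os j zero    _   = refl
freeCount-occupied os j (suc c) all rewrite all j ≤-refl (m<m+n j z<s) =
  freeCount-occupied os (suc j) c λ i j<i i<j+c → all i (<⇒≤ j<i) (subst (i <_) (sym (+-suc j c)) i<j+c)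

freeCount-∷-outside : ∀ s os j c → (∀ i → j ≤ i → i < j + c → s ≢ i) →
  freeCount (s ∷ os) j c ≡ freeCount os j c
freeCount-∷-outside s os j zero    _   = refl
freeCount-∷-outside s os j (suc c) out rewrite ≡ᵇ-false (out j ≤-refl (m<m+n j z<s)) =
  cong (𝟙 (not (occ os j)) +_)
    (freeCount-∷-outside s os (suc j) c λ i j<i i<j+c → out i (<⇒≤ j<i) (subst (i <_) (sym (+-suc j c)) i<j+c))

freeCount-∷-inside : ∀ s os j c → occ os s ≡ false → j ≤ s → s < j + c →
  suc (freeCount (s ∷ os) j c) ≡ freeCount os j c
freeCount-∷-inside s os j zero    _    j≤s s<j+0 = ⊥-elim (<⇒≱ s<j+0 (subst (_≤ s) (sym (+-identityʳ j)) j≤s))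
freeCount-∷-inside s os j (suc c) free j≤s s<j+c with m≤n⇒m<n∨m≡n j≤s
... | inj₂ refl rewrite ≡ᵇ-refl s | free =
  cong suc (freeCount-∷-outside s os (suc s) c λ i s<i _ s≡i → <-irrefl s≡i s<i)
... | inj₁ j<s rewrite ≡ᵇ-false (λ s≡j → <-irrefl (sym s≡j) j<s) =
  trans (sym (+-suc (𝟙 (not (occ os j))) _))
        (cong (𝟙 (not (occ os j)) +_) (freeCount-∷-inside s os (suc j) c free j<s (subst (s <_) (+-suc j c) s<j+c)))

module ParkingCriterion (n : ℕ) (L : ℕ → ℕ) (spot : ℕ → ℕ) where

  FirstLabelledAtSpot : ℕ → Set
  FirstLabelledAtSpot a = firstLabelled n L a ≡ just (spot a) × spot a < n

  demand : List ℕ → ℕ → ℕ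
  demand as j = sum (map (λ a → 𝟙 (j ≤ᵇ spot a)) as)

  free : List ℕ → ℕ → ℕ
  free os j = freeCount os j (n ∸ j)

  demand-antitone : ∀ as {i j} → i ≤ j → demand as j ≤ demand as i
  demand-antitone as i≤j = sum-map-mono _ _ (λ a → 𝟙-≤ᵇ-antitone (spot a) i≤j) as

  module Parked (os : List ℕ) {p s : ℕ} (p<n : p < n) (parks : firstFreeFrom n os p ≡ just s) where
    open IsFirstFrom (firstFrom-just p (n ∸ p) (λ i → not (occ os i)) parks)

    p≤s : p ≤ s
    p≤s = lower

    s<n : s < n
    s<n = subst (s <_) (m+[n∸m]≡n (<⇒≤ p<n)) upper

    free-removed : ∀ {j} → j ≤ s → suc (free (s ∷ os) j) ≡ free os j
    free-removed {j} j≤s = freeCount-∷-inside s os j (n ∸ j) (not-true holds) j≤s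
      (subst (s <_) (sym (m+[n∸m]≡n (≤-trans j≤s (<⇒≤ s<n)))) s<n)

    free-kept : ∀ {j} → s < j → free (s ∷ os) j ≡ free os j
    free-kept {j} s<j = freeCount-∷-outside s os j (n ∸ j) λ i j≤i _ s≡i → <-irrefl s≡i (<-≤-trans s<j j≤i)

    free-gap : ∀ {j} → p ≤ j → j ≤ s → free os j ≡ free os p
    free-gap {j} p≤j j≤s with m≤n⇒∃[o]m+o≡n p≤j | m≤n⇒∃[o]m+o≡n (≤-trans j≤s (<⇒≤ s<n))
    ... | d , refl | e , refl = sym (begin
      freeCount os p (p + d + e ∸ p)
        ≡⟨ cong (freeCount os p) (trans (cong (_∸ p) (+-assoc p d e)) (m+n∸m≡n p (d + e))) ⟩
      freeCount os p (d + e)                           ≡⟨ freeCount-+ os p d e ⟩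
      freeCount os p d + freeCount os (p + d) e
        ≡⟨ cong (_+ freeCount os (p + d) e) (freeCount-occupied os p d occupied) ⟩
      freeCount os (p + d) e                           ≡⟨ cong (freeCount os (p + d)) (sym (m+n∸m≡n (p + d) e)) ⟩
      freeCount os (p + d) (p + d + e ∸ (p + d))       ∎)
      where
      open ≡-Reasoning
      occupied : ∀ i → p ≤ i → i < p + d → occ os i ≡ true
      occupied i p≤i i<p+d = not-false (before i p≤i (<-≤-trans i<p+d j≤s))

  demand-∷-≤ : ∀ a as {j} → j ≤ spot a → demand (a ∷ as) j ≡ suc (demand as j)
  demand-∷-≤ a as {j} j≤p = cong (λ b → 𝟙 b + demand as j) (≤ᵇ-true j≤p)

  demand-∷-> : ∀ a as {j} → spot a < j → demand (a ∷ as) j ≡ demand as j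
  demand-∷-> a as {j} p<j = cong (λ b → 𝟙 b + demand as j) (≤ᵇ-false p<j)

  demand≤free : ∀ as os → All FirstLabelledAtSpot as → T (allParkFrom n L as os) → ∀ j → demand as j ≤ free os j
  demand≤free []       os _                  _    j = z≤n
  demand≤free (a ∷ as) os ((fl , p<n) ∷ fls) park j rewrite fl with firstFreeFrom n os (spot a) in parks
  ... | just s = step (j ≤? spot a) (j ≤? s)
    where
    open Parked os p<n parks
    ih : demand as j ≤ free (s ∷ os) j
    ih = demand≤free as (s ∷ os) fls park j
    step : Dec (j ≤ spot a) → Dec (j ≤ s) → demand (a ∷ as) j ≤ free os j
    step (yes j≤p) _         =
      subst₂ _≤_ (sym (demand-∷-≤ a as j≤p)) (free-removed (≤-trans j≤p p≤s)) (s≤s ih)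
    step (no  j≰p) (yes j≤s) =
      subst₂ _≤_ (sym (demand-∷-> a as (≰⇒> j≰p))) (free-removed j≤s) (m≤n⇒m≤1+n ih)
    step (no  j≰p) (no  j≰s) =
      subst₂ _≤_ (sym (demand-∷-> a as (≰⇒> j≰p))) (free-kept (≰⇒> j≰s)) ih

  demand≤free⇒allParkFrom : ∀ as os → All FirstLabelledAtSpot as → (∀ j → demand as j ≤ free os j) →
    T (allParkFrom n L as os)
  demand≤free⇒allParkFrom []       os _                  _    = tt
  demand≤free⇒allParkFrom (a ∷ as) os ((fl , p<n) ∷ fls) fits rewrite fl with firstFreeFrom n os (spot a) in parks
  ... | nothing = ⊥-elim (<⇒≱ (s≤s z≤n) (subst (suc (demand as (spot a)) ≤_) noneFree fitsAtSpot))
    where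
    fitsAtSpot : suc (demand as (spot a)) ≤ free os (spot a)
    fitsAtSpot = subst (_≤ free os (spot a)) (demand-∷-≤ a as ≤-refl) (fits (spot a))
    noneFree : free os (spot a) ≡ 0
    noneFree = freeCount-occupied os (spot a) (n ∸ spot a) λ i p≤i i<n →
      not-false (firstFrom-nothing (spot a) (n ∸ spot a) _ parks i p≤i i<n)
  ... | just s = demand≤free⇒allParkFrom as (s ∷ os) fls fits′
    where
    open Parked os p<n parks
    fits′ : ∀ j → demand as j ≤ free (s ∷ os) j
    fits′ j with j ≤? spot a | j ≤? s
    ... | yes j≤p | _       =
      s≤s⁻¹ (subst₂ _≤_ (demand-∷-≤ a as j≤p) (sym (free-removed (≤-trans j≤p p≤s))) (fits j))
    ... | no  j≰p | no  j≰s = subst₂ _≤_ (demand-∷-> a as (≰⇒> j≰p)) (sym (free-kept (≰⇒> j≰s))) (fits j)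
    ... | no  j≰p | yes j≤s = s≤s⁻¹ (begin
      suc (demand as j)            ≤⟨ s≤s (demand-antitone as (<⇒≤ (≰⇒> j≰p))) ⟩
      suc (demand as (spot a))     ≡⟨ demand-∷-≤ a as ≤-refl ⟨
      demand (a ∷ as) (spot a)     ≤⟨ fits (spot a) ⟩
      free os (spot a)             ≡⟨ free-gap (<⇒≤ (≰⇒> j≰p)) j≤s ⟨
      free os j                    ≡⟨ free-removed j≤s ⟨
      suc (free (s ∷ os) j)        ∎)
      where open ≤-Reasoning

  allPark⇔demand≤ : ∀ as → All FirstLabelledAtSpot as → T (allPark n L as) ⇔ (∀ j → demand as j ≤ n ∸ j)
  allPark⇔demand≤ as fls = mk⇔
    (λ park j → subst (demand as j ≤_) (freeCount-[] j (n ∸ j)) (demand≤free as [] fls park j))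
    (λ fits → demand≤free⇒allParkFrom as [] fls λ j →
      subst (demand as j ≤_) (sym (freeCount-[] j (n ∸ j))) (fits j))

IsLastMinimum : (ℕ → ℕ) → ℕ → ℕ → Set
IsLastMinimum g N k = (∀ r → r ≤ k → g k ≤ g r) × (∀ r → k < r → r ≤ N → g k < g r)

lastMinimum-minimum : ∀ {g N k} → k ≤ N → IsLastMinimum g N k → ∀ r → r ≤ N → g k ≤ g r
lastMinimum-minimum {k = k} k≤N (before , after) r r≤N with r ≤? k
... | yes r≤k = before r r≤k
... | no  r≰k = <⇒≤ (after r (≰⇒> r≰k) r≤N)

lastMinimum-exists : ∀ g N → ∃ λ k → k ≤ N × IsLastMinimum g N k
lastMinimum-exists g zero = 0 , z≤n , (λ { _ z≤n → ≤-refl }) , λ r 0<r r≤0 → ⊥-elim (<⇒≱ 0<r r≤0)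
lastMinimum-exists g (suc N) with lastMinimum-exists g N
... | k , k≤N , min with g (suc N) ≤? g k
...   | yes gN≤gk = suc N , ≤-refl , before , λ r N<r r≤N → ⊥-elim (<⇒≱ N<r r≤N)
  where
  before : ∀ r → r ≤ suc N → g (suc N) ≤ g r
  before r r≤sN with m≤n⇒m<n∨m≡n r≤sN
  ... | inj₁ r<sN = ≤-trans gN≤gk (lastMinimum-minimum k≤N min r (s≤s⁻¹ r<sN))
  ... | inj₂ refl = ≤-refl
...   | no  gN≰gk = k , m≤n⇒m≤1+n k≤N , proj₁ min , after
  where
  after : ∀ r → k < r → r ≤ suc N → g k < g r
  after r k<r r≤sN with m≤n⇒m<n∨m≡n r≤sN
  ... | inj₁ r<sN = proj₂ min r k<r (s≤s⁻¹ r<sN)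
  ... | inj₂ refl = ≰⇒> gN≰gk

lastMinimum-unique : ∀ {g N k k′} → k ≤ N → k′ ≤ N →
  IsLastMinimum g N k → IsLastMinimum g N k′ → k ≡ k′
lastMinimum-unique {k = k} {k′} k≤N k′≤N min min′ with <-cmp k k′
... | tri≈ _ k≡k′ _ = k≡k′
... | tri< k<k′ _ _ = ⊥-elim (<⇒≱ (proj₂ min k′ k<k′ k′≤N) (proj₁ min′ k (<⇒≤ k<k′)))
... | tri> _ _ k′<k = ⊥-elim (<⇒≱ (proj₂ min′ k k′<k k≤N) (proj₁ min k′ (<⇒≤ k′<k)))

countUpTo : List ℕ → ℕ → ℕ
countUpTo as r = sum (map (λ a → 𝟙 (a ≤ᵇ r)) as)

-- S(r) + N in the notation above, where N = n − 1, so that it stays in ℕ.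
potential : List ℕ → ℕ → ℕ → ℕ
potential as N r = countUpTo as r + (N ∸ r)

IsLabel : ℕ → ℕ → Set
IsLabel N a = 1 ≤ a × a ≤ N

-- The street with k = k₀ + 1 and N = k₀ + 1 + e labels, written so that no truncated
-- subtraction occurs.
module Street (k₀ e : ℕ) where

  N : ℕ
  N = suc k₀ + e

  label : ℕ → ℕ
  label = streetLabel (suc N) (suc k₀)

  label-unwrapped : ∀ j → suc k₀ + j ≤ N → label (suc j) ≡ suc k₀ + j
  label-unwrapped j k+j≤N rewrite ≤ᵇ-true k+j≤N = refl

  label-wrapped : ∀ j → N < suc k₀ + j → label (suc j) ≡ suc k₀ + j ∸ N
  label-wrapped j N<k+j rewrite ≤ᵇ-false N<k+j = refl

  firstSpot : ℕ → ℕ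
  firstSpot a with <-cmp a (suc k₀)
  ... | tri< _ _ _ = suc e + a
  ... | tri≈ _ _ _ = 0
  ... | tri> _ _ _ = a ∸ k₀

  open ParkingCriterion (suc N) label firstSpot public

  firstSpot-correct : ∀ {a} → IsLabel N a → FirstLabelledAtSpot a
  firstSpot-correct {a} (1≤a , a≤N) with <-cmp a (suc k₀)
  ... | tri≈ _ refl _ = firstLabelled-char (suc N) label a (s≤s z≤n) refl (λ _ ()) , s≤s z≤n
  ... | tri> _ _ k<a with m≤n⇒∃[o]m+o≡n (<⇒≤ k<a)
  ...   | j , refl rewrite 1+m+n∸m≡1+n k₀ j =
    firstLabelled-char (suc N) label _ p<n (label-unwrapped j a≤N) earlier , p<n
    where
    p<n : suc j < suc N
    p<n = s≤s (≤-trans (s≤s (m≤n+m j k₀)) a≤N)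
    earlier : ∀ i → i < suc j → label i ≢ suc k₀ + j
    earlier zero    _   k≡a = <-irrefl k≡a k<a
    earlier (suc i) i<j ℓ≡a = <-irrefl (trans (sym (label-unwrapped i (≤-trans (<⇒≤ k+i<k+j) a≤N))) ℓ≡a) k+i<k+j
      where k+i<k+j = +-monoʳ-< (suc k₀) (s≤s⁻¹ i<j)
  firstSpot-correct {suc a} (_ , a≤N) | tri< a<k _ _ = firstLabelled-char (suc N) label (suc a) p<n labelled earlier , p<n
    where
    N+a≡ : N + suc a ≡ suc k₀ + (e + suc a)
    N+a≡ = +-assoc (suc k₀) e (suc a)
    p<n : suc (e + suc a) < suc N
    p<n = s≤s (s≤s (subst (e + suc a ≤_) (+-comm e k₀) (+-monoʳ-≤ e (s≤s⁻¹ a<k))))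
    labelled : label (suc (e + suc a)) ≡ suc a
    labelled = trans (label-wrapped (e + suc a) (subst (N <_) N+a≡ (m<m+n N (s≤s z≤n))))
                     (trans (cong (_∸ N) (sym N+a≡)) (m+n∸m≡n N (suc a)))
    earlier : ∀ i → i < suc (e + suc a) → label i ≢ suc a
    earlier zero    _   k≡a = <-irrefl (sym k≡a) a<k
    earlier (suc i) i<p ℓ≡a with suc k₀ + i ≤? N
    ... | yes k+i≤N = <-irrefl (trans (sym ℓ≡a) (label-unwrapped i k+i≤N)) (<-≤-trans a<k (m≤m+n (suc k₀) i))
    ... | no  k+i≰N = <-irrefl (trans (sym (label-wrapped i (≰⇒> k+i≰N))) ℓ≡a)
                        (m<n+o⇒m∸n<o (suc k₀ + i) N
                          (subst (suc k₀ + i <_) (sym N+a≡) (+-monoʳ-< (suc k₀) (s≤s⁻¹ i<p))))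

  firstSpot≢1 : ∀ {a} → 1 ≤ a → firstSpot a ≢ 1
  firstSpot≢1 {a} 1≤a with <-cmp a (suc k₀)
  ... | tri< _ _ _  = λ e+a≡0 → <⇒≱ 1≤a (≤-reflexive (m+n≡0⇒n≡0 e (suc-injective e+a≡0)))
  ... | tri≈ _ _ _  = λ ()
  ... | tri> _ _ k<a = λ a-k≡1 →
    <⇒≱ k<a (subst (a ≤_) (trans (cong (k₀ +_) a-k≡1) (+-comm k₀ 1)) (m≤n+m∸n a k₀))

  -- The spots after t carry the labels k₀ + t + 1, …, N and all labels ≤ k₀ when t ≤ e + 1,
  -- and the labels s + 1, …, k₀ when t = e + 1 + s.
  spot-unwrapped : ∀ {t a} → 1 ≤ t → t ≤ suc e → IsLabel N a →
    𝟙 (suc t ≤ᵇ firstSpot a) + 𝟙 (a ≤ᵇ k₀ + t) ≡ 1 + 𝟙 (a ≤ᵇ k₀)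
  spot-unwrapped {t} {a} 1≤t t≤e (1≤a , _) with <-cmp a (suc k₀)
  ... | tri< a<k _ _ rewrite ≤ᵇ-true (s≤s (≤-trans t≤e (subst (_≤ e + a) (+-comm e 1) (+-monoʳ-≤ e 1≤a))))
                           | ≤ᵇ-true (≤-trans (s≤s⁻¹ a<k) (m≤m+n k₀ t)) | ≤ᵇ-true (s≤s⁻¹ a<k) = refl
  ... | tri≈ _ refl _ rewrite ≤ᵇ-true (subst (_≤ k₀ + t) (+-comm k₀ 1) (+-monoʳ-≤ k₀ 1≤t))
                            | ≤ᵇ-false (n<1+n k₀) = refl
  ... | tri> _ _ k<a rewrite ≤ᵇ-false (<-trans (n<1+n k₀) k<a) with a ≤? k₀ + t
  ...   | yes a≤k+t rewrite ≤ᵇ-true a≤k+t | ≤ᵇ-false (s≤s (m≤n+o⇒m∸n≤o a k₀ a≤k+t)) = refl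
  ...   | no  a≰k+t rewrite ≤ᵇ-false (≰⇒> a≰k+t)
                          | ≤ᵇ-true (m+n≤o⇒m≤o∸n (suc t) (subst (_≤ a) (cong suc (+-comm k₀ t)) (≰⇒> a≰k+t)))
                          = refl

  spot-wrapped : ∀ {s a} → s ≤ k₀ → IsLabel N a →
    𝟙 (suc (suc e + s) ≤ᵇ firstSpot a) + 𝟙 (a ≤ᵇ s) ≡ 𝟙 (a ≤ᵇ k₀)
  spot-wrapped {s} {a} s≤k (_ , a≤N) with <-cmp a (suc k₀)
  ... | tri< a<k _ _ rewrite ≤ᵇ-true (s≤s⁻¹ a<k) with a ≤? s
  ...   | yes a≤s rewrite ≤ᵇ-true a≤s | ≤ᵇ-false (s≤s (+-monoʳ-≤ (suc e) a≤s)) = refl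
  ...   | no  a≰s rewrite ≤ᵇ-false (≰⇒> a≰s)
                        | ≤ᵇ-true (subst (_≤ suc e + a) (+-suc (suc e) s) (+-monoʳ-≤ (suc e) (≰⇒> a≰s))) = refl
  spot-wrapped {s} s≤k _ | tri≈ _ refl _ rewrite ≤ᵇ-false (s≤s s≤k) | ≤ᵇ-false (n<1+n k₀) = refl
  spot-wrapped {s} {a} s≤k (_ , a≤N) | tri> _ _ k<a
    rewrite ≤ᵇ-false (<-trans (s≤s s≤k) k<a) | ≤ᵇ-false (<-trans (n<1+n k₀) k<a)
          | ≤ᵇ-false (s≤s (≤-trans (m≤n+o⇒m∸n≤o a k₀ (subst (a ≤_) (sym (+-suc k₀ e)) a≤N)) (m≤m+n (suc e) s)))
          = refl

  firstSpot-≤ : ∀ {a} → IsLabel N a → firstSpot a ≤ N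
  firstSpot-≤ label-a = s≤s⁻¹ (proj₂ (firstSpot-correct label-a))

  module _ {as : List ℕ} (labels : All (IsLabel N) as) where

    demand-unwrapped : ∀ {t} → 1 ≤ t → t ≤ suc e →
      demand as (suc t) + countUpTo as (k₀ + t) ≡ length as + countUpTo as k₀
    demand-unwrapped {t} 1≤t t≤e = begin
      demand as (suc t) + countUpTo as (k₀ + t)                     ≡⟨ sym (sum-map-+ _ _ as) ⟩
      sum (map (λ a → 𝟙 (suc t ≤ᵇ firstSpot a) + 𝟙 (a ≤ᵇ k₀ + t)) as)
        ≡⟨ sum-map-cong _ _ (λ _ → spot-unwrapped 1≤t t≤e) labels ⟩
      sum (map (λ a → 1 + 𝟙 (a ≤ᵇ k₀)) as)                          ≡⟨ sum-map-+ _ _ as ⟩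
      sum (map (λ _ → 1) as) + countUpTo as k₀                      ≡⟨ cong (_+ countUpTo as k₀) (sum-map-one as) ⟩
      length as + countUpTo as k₀                                   ∎
      where open ≡-Reasoning

    demand-wrapped : ∀ {s} → s ≤ k₀ → demand as (suc (suc e + s)) + countUpTo as s ≡ countUpTo as k₀
    demand-wrapped s≤k = trans (sym (sum-map-+ _ _ as)) (sum-map-cong _ _ (λ _ → spot-wrapped s≤k) labels)

    demand-beyond : ∀ {t} → N ≤ t → demand as (suc t) ≡ 0
    demand-beyond N≤t =
      sum-map-zero _ (λ _ label-a → cong 𝟙 (≤ᵇ-false (s≤s (≤-trans (firstSpot-≤ label-a) N≤t)))) labels

    demand-1 : demand as 1 ≡ demand as 2
    demand-1 = sum-map-cong _ _ (λ _ (1≤a , _) → 𝟙-1≤ᵇ≡𝟙-2≤ᵇ (firstSpot≢1 1≤a)) labels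
      where
      𝟙-1≤ᵇ≡𝟙-2≤ᵇ : ∀ {p} → p ≢ 1 → 𝟙 (1 ≤ᵇ p) ≡ 𝟙 (2 ≤ᵇ p)
      𝟙-1≤ᵇ≡𝟙-2≤ᵇ {zero}        _   = refl
      𝟙-1≤ᵇ≡𝟙-2≤ᵇ {suc zero}    p≢1 = ⊥-elim (p≢1 refl)
      𝟙-1≤ᵇ≡𝟙-2≤ᵇ {suc (suc p)} _   = refl

    module _ (len : length as ≡ suc N) where

      private
        P = countUpTo as
        pot = potential as N
        open SetoidReasoning (⇔-setoid 0ℓ)

      unwrapped⇔ : ∀ {t} → 1 ≤ t → t ≤ suc e → demand as (suc t) ≤ N ∸ t ⇔ pot k₀ < pot (k₀ + t)
      unwrapped⇔ {t} 1≤t t≤e with m≤n⇒∃[o]m+o≡n t≤e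
      ... | f , t+f≡e = begin
        demand as (suc t) ≤ N ∸ t                     ≡⟨ cong (demand as (suc t) ≤_) N∸t ⟩
        demand as (suc t) ≤ k₀ + f                    ≈⟨ +-monoˡ-≤-⇔ (P (k₀ + t)) ⟩
        demand as (suc t) + P (k₀ + t) ≤ k₀ + f + P (k₀ + t)
          ≡⟨ cong₂ _≤_ (trans (demand-unwrapped 1≤t t≤e) (trans (cong (_+ P k₀) len) (reassocˡ k₀ e (P k₀))))
                       (reassocʳ k₀ f (P (k₀ + t))) ⟩
        k₀ + suc (P k₀ + suc e) ≤ k₀ + (P (k₀ + t) + f) ≈⟨ +-monoʳ-≤-⇔ k₀ ⟨
        P k₀ + suc e < P (k₀ + t) + f
          ≡⟨ cong₂ _<_ (cong (P k₀ +_) (sym (1+m+n∸m≡1+n k₀ e))) (cong (P (k₀ + t) +_) (sym N∸[k₀+t])) ⟩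
        pot k₀ < pot (k₀ + t)                          ∎
        where
        N≡ : N ≡ k₀ + (t + f)
        N≡ = trans (sym (+-suc k₀ e)) (cong (k₀ +_) (sym t+f≡e))
        N∸t : N ∸ t ≡ k₀ + f
        N∸t = trans (cong (_∸ t) (trans N≡ (sym (x∙yz≈y∙xz t k₀ f)))) (m+n∸m≡n t (k₀ + f))
        N∸[k₀+t] : N ∸ (k₀ + t) ≡ f
        N∸[k₀+t] = trans (cong (_∸ (k₀ + t)) (trans N≡ (sym (+-assoc k₀ t f)))) (m+n∸m≡n (k₀ + t) f)
        reassocˡ : ∀ k e p → suc (suc k + e) + p ≡ k + suc (p + suc e)
        reassocˡ = solve-∀
        reassocʳ : ∀ k f p → k + f + p ≡ k + (p + f)
        reassocʳ = solve-∀

      wrapped⇔ : ∀ {s} → s ≤ k₀ → demand as (suc (suc e + s)) ≤ N ∸ (suc e + s) ⇔ pot k₀ ≤ pot s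
      wrapped⇔ {s} s≤k with m≤n⇒∃[o]m+o≡n s≤k
      ... | d , refl = begin
        demand as (suc (suc e + s)) ≤ N ∸ (suc e + s)     ≡⟨ cong (demand as (suc (suc e + s)) ≤_) N∸t ⟩
        demand as (suc (suc e + s)) ≤ d                   ≈⟨ +-monoˡ-≤-⇔ (P s) ⟩
        demand as (suc (suc e + s)) + P s ≤ d + P s       ≡⟨ cong (_≤ d + P s) (demand-wrapped s≤k) ⟩
        P (s + d) ≤ d + P s                               ≈⟨ +-monoˡ-≤-⇔ (suc e) ⟩
        P (s + d) + suc e ≤ d + P s + suc e
          ≡⟨ cong₂ _≤_ (cong (P (s + d) +_) (sym (1+m+n∸m≡1+n (s + d) e)))
                       (trans (reassoc d (P s) e) (cong (P s +_) (sym N∸s))) ⟩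
        pot (s + d) ≤ pot s                               ∎
        where
        N∸t : N ∸ (suc e + s) ≡ d
        N∸t = trans (cong (_∸ (suc e + s)) (N≡ᵗ s d e)) (m+n∸m≡n (suc e + s) d)
          where
          N≡ᵗ : ∀ s d e → suc (s + d) + e ≡ suc e + s + d
          N≡ᵗ = solve-∀
        N∸s : N ∸ s ≡ d + suc e
        N∸s = trans (cong (_∸ s) (N≡ˢ s d e)) (m+n∸m≡n s (d + suc e))
          where
          N≡ˢ : ∀ s d e → suc (s + d) + e ≡ s + (d + suc e)
          N≡ˢ = solve-∀
        reassoc : ∀ d p e → d + p + suc e ≡ p + (d + suc e)
        reassoc = solve-∀

      fits⇔lastMinimum : (∀ j → demand as j ≤ suc N ∸ j) ⇔ IsLastMinimum pot N k₀
      fits⇔lastMinimum = mk⇔ (λ fits → before fits , after fits) fits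
        where
        before : (∀ j → demand as j ≤ suc N ∸ j) → ∀ r → r ≤ k₀ → pot k₀ ≤ pot r
        before fits r r≤k = Equivalence.to (wrapped⇔ r≤k) (fits (suc (suc e + r)))

        after : (∀ j → demand as j ≤ suc N ∸ j) → ∀ r → k₀ < r → r ≤ N → pot k₀ < pot r
        after fits r k<r r≤N with m≤n⇒∃[o]m+o≡n (<⇒≤ k<r)
        ... | t , refl = Equivalence.to (unwrapped⇔ 1≤t t≤e) (fits (suc t))
          where
          1≤t : 1 ≤ t
          1≤t = +-cancelˡ-< k₀ 0 t (subst (_< k₀ + t) (sym (+-identityʳ k₀)) k<r)
          t≤e : t ≤ suc e
          t≤e = +-cancelˡ-≤ k₀ t (suc e) (subst (k₀ + t ≤_) (sym (+-suc k₀ e)) r≤N)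

        fits-suc : IsLastMinimum pot N k₀ → ∀ {t} → 1 ≤ t → demand as (suc t) ≤ N ∸ t
        fits-suc (before , after) {t} 1≤t with t ≤? suc e
        ... | yes t≤e = Equivalence.from (unwrapped⇔ 1≤t t≤e)
                          (after (k₀ + t) (m<m+n k₀ 1≤t) (subst (k₀ + t ≤_) (+-suc k₀ e) (+-monoʳ-≤ k₀ t≤e)))
        ... | no  t≰e with t ≤? N
        ...   | no  t≰N = subst (_≤ N ∸ t) (sym (demand-beyond (<⇒≤ (≰⇒> t≰N)))) z≤n
        ...   | yes t≤N with m≤n⇒∃[o]m+o≡n (<⇒≤ (≰⇒> t≰e))
        ...     | s , refl = Equivalence.from (wrapped⇔ s≤k) (before s s≤k)
          where
          s≤k : s ≤ k₀
          s≤k = +-cancelˡ-≤ (suc e) s k₀ (subst (suc e + s ≤_) (cong suc (+-comm k₀ e)) t≤N)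

        fits : IsLastMinimum pot N k₀ → ∀ j → demand as j ≤ suc N ∸ j
        fits _   zero          = ≤-reflexive (trans (sum-map-one as) len)
        fits min (suc zero)    = subst (_≤ N) (sym demand-1) (≤-trans (fits-suc min (s≤s z≤n)) (m∸n≤m N 1))
        fits min (suc (suc t)) = fits-suc min (s≤s z≤n)

      allPark⇔lastMinimum : T (allPark (suc N) label as) ⇔ IsLastMinimum pot N k₀
      allPark⇔lastMinimum = ⇔-trans (allPark⇔demand≤ as (All.map firstSpot-correct labels)) fits⇔lastMinimum

allPark⇔lastMinimum : ∀ {N k₀ as} → k₀ < N → All (IsLabel N) as → length as ≡ suc N →
  T (allPark (suc N) (streetLabel (suc N) (suc k₀)) as) ⇔ IsLastMinimum (potential as N) N k₀
allPark⇔lastMinimum {k₀ = k₀} k₀<N labels len with m≤n⇒∃[o]m+o≡n k₀<N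
... | e , refl = Street.allPark⇔lastMinimum k₀ e labels len

lastMinimum-< : ∀ {N k as} → All (IsLabel N) as → length as ≡ suc N → k ≤ N →
  IsLastMinimum (potential as N) N k → k < N
lastMinimum-< {N} {k} {as} labels len k≤N (before , _) with m≤n⇒m<n∨m≡n k≤N
... | inj₁ k<N = k<N
... | inj₂ refl = ⊥-elim (<-irrefl refl (subst₂ _≤_ potential-N potential-0 (before 0 z≤n)))
  where
  potential-N : potential as N N ≡ suc N
  potential-N = trans (cong₂ _+_ countUpTo-N (n∸n≡0 N)) (+-identityʳ (suc N))
    where
    countUpTo-N : countUpTo as N ≡ suc N
    countUpTo-N =
      trans (sum-map-cong _ _ (λ _ (_ , a≤N) → cong 𝟙 (≤ᵇ-true a≤N)) labels) (trans (sum-map-one as) len)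
  potential-0 : potential as N 0 ≡ N
  potential-0 = cong (_+ N) (sum-map-zero _ (λ _ (1≤a , _) → cong 𝟙 (≤ᵇ-false 1≤a)) labels)

prefList-labels : ∀ {n l} (p : Fin n → Fin l) → All (IsLabel l) (prefList p)
prefList-labels p = map⁺ (tabulate⁺ λ i → s≤s z≤n , toℕ<n (p i))

prefList-length : ∀ {n l} (p : Fin n → Fin l) → length (prefList p) ≡ n
prefList-length {n} p = trans (length-map _ (allFin n)) (length-tabulate id)

∃!-parkingLabel : ∀ {N as} → All (IsLabel N) as → length as ≡ suc N →
  ∃! _≡_ (λ (k : Fin N) → T (allPark (suc N) (streetLabel (suc N) (suc (toℕ k))) as))
∃!-parkingLabel {N} {as} labels len with lastMinimum-exists (potential as N) N
... | k , k≤N , min = fromℕ< k<N , Equivalence.from (parks⇔ (fromℕ< k<N)) min′ , unique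
  where
  parks⇔ : ∀ k → T (allPark (suc N) (streetLabel (suc N) (suc (toℕ k))) as) ⇔
                  IsLastMinimum (potential as N) N (toℕ k)
  parks⇔ k = allPark⇔lastMinimum (toℕ<n k) labels len
  k<N : k < N
  k<N = lastMinimum-< labels len k≤N min
  min′ : IsLastMinimum (potential as N) N (toℕ (fromℕ< k<N))
  min′ = subst (IsLastMinimum (potential as N) N) (sym (toℕ-fromℕ< k<N)) min
  unique : ∀ {k′} → T (allPark (suc N) (streetLabel (suc N) (suc (toℕ k′))) as) → fromℕ< k<N ≡ k′
  unique {k′} park = toℕ-injective (trans (toℕ-fromℕ< k<N)
    (lastMinimum-unique k≤N (<⇒≤ (toℕ<n k′)) min (Equivalence.to (parks⇔ k′) park)))

mainTheorem2 : (m : ℕ) → (p : Fin (suc (suc m)) → Fin (suc m)) →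
    ∃! _≡_ (λ (k : Fin (suc m)) →
      T (allPark (suc (suc m)) (streetLabel (suc (suc m)) (labelOf k)) (prefList p)))
mainTheorem2 m p = ∃!-parkingLabel (prefList-labels p) (prefList-length p)
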